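{- Let $N$ be an odd perfect number, and write its prime factorization as $N=p_1^{a_1}p_2^{a_2}\cdots p_k^{a_k}$ with primes $p_1<p_2<\cdots<p_k$, where $k\ge 2$ and each $a_i\ge 1$. Then $$p_{k-1}p_k < 2^{1/4}3^{1/4}N^{1/2} = 6^{1/4}N^{1/2}.$$
   Context: A positive integer $N$ is perfect if $\sigma(N)=2N$, where $\sigma$ denotes the sum-of-divisors function; an odd perfect number is an odd positive integer with this property. -}

module Defs where

open import Data.Nat using (ℕ; _*_)
open import Data.Nat.Divisibility using (_∣_; _∣?_)
open import Data.List using (List; filter)
open import Data.Nat.ListAction using (sum)
open import Data.List.Base using (upTo)
open import Relation.Nullary using (¬_)
open import Relation.Binary.PropositionalEquality using (_≡_)
open import Data.Nat using (suc)

-- divisors of n: all d ∈ {1, …, n} with d ∣ n   (upTo n = [0 … n-1], so shift by 1)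
divisors : ℕ → List ℕ
divisors n = filter (_∣? n) (Data.List.map suc (upTo n))

σ : ℕ → ℕ
σ n = sum (divisors n)

Perfect : ℕ → Set
Perfect n = σ n ≡ 2 * n

Odd : ℕ → Set
Odd n = ¬ (2 ∣ n)

module Submission where

-- Write N = p^a · q^b · M with a, b ≥ 1 and p, q ∤ M.
-- Multiplicativity of σ on prime-power parts turns σ(N) = 2N into σ(p^a) · σ(q^b) · σ(M) = 2N.
-- Almost every case ends with one estimate (halfBound): if A·h ≤ N and c < 2h then
-- (A·c)² < 4N² < 6N², used with A·c = p²q²:
--   a, b ≥ 2       : A = p²q, c = h = q;
--   a = b = 1      : impossible, since σ(p) and σ(q) are both even while 4 ∤ 2N;
--   a = 1, b ≥ 2   : σ(p) = p + 1 = 2h with h ∣ M, and A = pq², c = p;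
--   a ≥ 2, b = 1   : σ(q) = q + 1 = 2h and A = p²q, c = q; if p ∤ h then h ∣ M; otherwise q divides
--                    σ(M) (and then h ≤ M), or σ(p^a) = s·q, where s ≡ -1 (mod p) gives p ≤ s ≤ M and
--                    the closed form (p - 1)·σ(p^a) + 1 = p^(a+1) gives the bound (geometricBound).

open import Defs
open import Data.Nat using (ℕ; _*_; _^_; _<_; _≤_)
open import Data.Nat.Divisibility using (_∣_)
open import Data.Nat.Primality using (Prime)
open import Data.Sum using (_⊎_)
open import Relation.Binary.PropositionalEquality using (_≡_)

open import Data.Nat
open import Data.Nat.Properties
open import Data.Nat.Divisibility
open import Data.Nat.Primality
open import Data.Nat.Coprimality using (Coprime; coprime-divisor; prime⇒coprime)
  renaming (sym to coprime-sym)
open import Data.Nat.Induction using (<-rec)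
open import Data.Nat.ListAction using (sum)
open import Data.Nat.ListAction.Properties using (sum-↭; sum-++)
open import Data.Nat.Tactic.RingSolver using (solve-∀)
open import Data.List using (List; []; _∷_; _++_; map; upTo)
open import Data.List.Membership.Propositional using (_∈_)
open import Data.List.Membership.Propositional.Properties
open import Data.List.Membership.Propositional.Properties.WithK using (unique∧set⇒bag)
open import Data.List.Relation.Binary.BagAndSetEquality using (∼bag⇒↭)
open import Data.List.Relation.Unary.Unique.Propositional using (Unique)
import Data.List.Relation.Unary.Unique.Propositional.Properties as Unique
open import Data.Product using (∃; ∃₂; _×_; _,_; proj₂)
open import Data.Sum using (inj₁; inj₂)
open import Data.Empty using (⊥; ⊥-elim)
open import Function.Bundles using (_⇔_; mk⇔)
open import Relation.Nullary using (¬_; yes; no; contradiction)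
open import Relation.Binary.PropositionalEquality
  using (_≢_; refl; sym; trans; cong; subst; subst₂; module ≡-Reasoning)

prime∤⇒coprime : ∀ {r x} → Prime r → ¬ r ∣ x → Coprime x r
prime∤⇒coprime r-prime r∤x (i∣x , i∣r) with prime⇒irreducible r-prime i∣r
... | inj₁ i≡1 = i≡1
... | inj₂ refl = contradiction i∣x r∤x

coprime-pow-divisor : ∀ {r d m} → Coprime d r → ∀ e → d ∣ r ^ e * m → d ∣ m
coprime-pow-divisor {d = d} {m} d⊥r zero d∣m = subst (d ∣_) (*-identityˡ m) d∣m
coprime-pow-divisor {r} {d} {m} d⊥r (suc e) d∣rrm =
  coprime-pow-divisor d⊥r e (coprime-divisor d⊥r (subst (d ∣_) (*-assoc r (r ^ e) m) d∣rrm))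

splitPower : ∀ {r} → 1 < r → ∀ n → n ≢ 0 → ∃₂ λ e y → n ≡ r ^ e * y × ¬ r ∣ y
splitPower {r} 1<r = <-rec _ split
  where
  split : ∀ n → (∀ {k} → k < n → k ≢ 0 → ∃₂ λ e y → k ≡ r ^ e * y × ¬ r ∣ y) →
          n ≢ 0 → ∃₂ λ e y → n ≡ r ^ e * y × ¬ r ∣ y
  split n rec n≢0 with r ∣? n
  ... | no r∤n = 0 , n , sym (*-identityˡ n) , r∤n
  ... | yes (divides k n≡k*r) with rec k<n k≢0
    where
    k≢0 : k ≢ 0
    k≢0 refl = n≢0 n≡k*r
    k<n : k < n
    k<n = subst (k <_) (sym n≡k*r) (m<m*n k r {{≢-nonZero k≢0}} 1<r)
  ... | e , y , k≡ , r∤y = suc e , y , n≡ , r∤y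
    where
    open ≡-Reasoning
    n≡ : n ≡ r ^ suc e * y
    n≡ = begin
      n                ≡⟨ n≡k*r ⟩
      k * r            ≡⟨ cong (_* r) k≡ ⟩
      r ^ e * y * r    ≡⟨ *-comm (r ^ e * y) r ⟩
      r * (r ^ e * y)  ≡⟨ *-assoc r (r ^ e) y ⟨
      r ^ suc e * y    ∎

sum-unique-cong : ∀ {xs ys : List ℕ} → Unique xs → Unique ys →
                  (∀ {x} → x ∈ xs ⇔ x ∈ ys) → sum xs ≡ sum ys
sum-unique-cong xs-unique ys-unique same =
  sum-↭ (∼bag⇒↭ (unique∧set⇒bag xs-unique ys-unique same))

sum-map-* : ∀ c xs → sum (map (c *_) xs) ≡ c * sum xs
sum-map-* c [] = sym (*-zeroʳ c)
sum-map-* c (x ∷ xs) = trans (cong (c * x +_) (sum-map-* c xs)) (sym (*-distribˡ-+ c x (sum xs)))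

divisors-unique : ∀ n → Unique (divisors n)
divisors-unique n = Unique.filter⁺ (_∣? n) (Unique.map⁺ suc-injective (Unique.upTo⁺ n))

∈-divisors⁻ : ∀ {n d} → d ∈ divisors n → d ∣ n
∈-divisors⁻ {n} d∈ = proj₂ (∈-filter⁻ (_∣? n) {xs = map suc (upTo n)} d∈)

∈-divisors⁺ : ∀ {n d} .{{_ : NonZero n}} → d ∣ n → d ∈ divisors n
∈-divisors⁺ {n} {zero} 0∣n = contradiction (0∣⇒≡0 0∣n) (≢-nonZero⁻¹ n)
∈-divisors⁺ {n} {suc d} d∣n = ∈-filter⁺ (_∣? n) (∈-map⁺ suc (∈-upTo⁺ (∣⇒≤ d∣n))) d∣n

-- geomSum r e = 1 + r + r² + ⋯ + r^e, written in Horner form; it is σ(r^e) for prime r.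
geomSum : ℕ → ℕ → ℕ
geomSum r zero = 1
geomSum r (suc e) = 1 + r * geomSum r e

module PrimePowerPart {r m : ℕ} (r-prime : Prime r) (r∤m : ¬ r ∣ m) .{{_ : NonZero m}} where

  instance
    r≢0 : NonZero r
    r≢0 = prime⇒nonZero r-prime

  rᵉm≢0 : ∀ e → NonZero (r ^ e * m)
  rᵉm≢0 e = m*n≢0 (r ^ e) m {{m^n≢0 r e}}

  divisors-step : ∀ e {x} →
    x ∈ divisors (r * (r ^ e * m)) ⇔ x ∈ divisors m ++ map (r *_) (divisors (r ^ e * m))
  divisors-step e {x} = mk⇔ to from
    where
    instance _ = rᵉm≢0 e
    instance _ = m*n≢0 r (r ^ e * m) {{r≢0}} {{rᵉm≢0 e}}
    to : x ∈ divisors (r * (r ^ e * m)) → x ∈ divisors m ++ map (r *_) (divisors (r ^ e * m))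
    to x∈ with r ∣? x
    ... | no r∤x = ∈-++⁺ˡ (∈-divisors⁺ (coprime-pow-divisor (prime∤⇒coprime r-prime r∤x) (suc e)
                                          (subst (x ∣_) (sym (*-assoc r (r ^ e) m)) (∈-divisors⁻ x∈))))
    ... | yes (divides y refl) =
      ∈-++⁺ʳ (divisors m) (subst (_∈ map (r *_) (divisors (r ^ e * m))) (*-comm r y)
        (∈-map⁺ (r *_) (∈-divisors⁺ (*-cancelˡ-∣ r (subst (_∣ r * (r ^ e * m)) (*-comm y r) (∈-divisors⁻ x∈))))))
    from : x ∈ divisors m ++ map (r *_) (divisors (r ^ e * m)) → x ∈ divisors (r * (r ^ e * m))
    from x∈ with ∈-++⁻ (divisors m) x∈
    ... | inj₁ x∈m = ∈-divisors⁺ (∣n⇒∣m*n r (∣n⇒∣m*n (r ^ e) (∈-divisors⁻ x∈m)))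
    ... | inj₂ x∈rD with ∈-map⁻ (r *_) x∈rD
    ...   | y , y∈ , refl = ∈-divisors⁺ (*-monoʳ-∣ r (∈-divisors⁻ y∈))

  -- The two halves of that decomposition share no element: r divides every member of the second.
  divisors-step-unique : ∀ e → Unique (divisors m ++ map (r *_) (divisors (r ^ e * m)))
  divisors-step-unique e = Unique.++⁺ (divisors-unique m)
    (Unique.map⁺ (λ {x} {y} → *-cancelˡ-≡ x y r) (divisors-unique (r ^ e * m))) disjoint
    where
    disjoint : ∀ {x} → ¬ (x ∈ divisors m × x ∈ map (r *_) (divisors (r ^ e * m)))
    disjoint (x∈m , x∈rD) with ∈-map⁻ (r *_) x∈rD
    ... | y , _ , refl = r∤m (∣-trans (m∣m*n y) (∈-divisors⁻ x∈m))

  σ-step : ∀ e → σ (r * (r ^ e * m)) ≡ σ m + r * σ (r ^ e * m)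
  σ-step e = begin
    σ (r * (r ^ e * m))                                    ≡⟨ sum-unique-cong (divisors-unique (r * (r ^ e * m)))
                                                                (divisors-step-unique e) (divisors-step e) ⟩
    sum (divisors m ++ map (r *_) (divisors (r ^ e * m)))  ≡⟨ sum-++ (divisors m) _ ⟩
    σ m + sum (map (r *_) (divisors (r ^ e * m)))          ≡⟨ cong (σ m +_) (sum-map-* r (divisors (r ^ e * m))) ⟩
    σ m + r * σ (r ^ e * m)                                ∎
    where open ≡-Reasoning

  σ-prime-power : ∀ e → σ (r ^ e * m) ≡ geomSum r e * σ m
  σ-prime-power zero = trans (cong σ (*-identityˡ m)) (sym (*-identityˡ (σ m)))
  σ-prime-power (suc e) = begin
    σ (r * r ^ e * m)              ≡⟨ cong σ (*-assoc r (r ^ e) m) ⟩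
    σ (r * (r ^ e * m))            ≡⟨ σ-step e ⟩
    σ m + r * σ (r ^ e * m)        ≡⟨ cong (λ s → σ m + r * s) (σ-prime-power e) ⟩
    σ m + r * (geomSum r e * σ m)  ≡⟨ distribute (σ m) r (geomSum r e) ⟩
    geomSum r (suc e) * σ m        ∎
    where
    open ≡-Reasoning
    distribute : ∀ s r g → s + r * (g * s) ≡ (1 + r * g) * s
    distribute = solve-∀

prime>1 : ∀ {r} → Prime r → 1 < r
prime>1 {r} r-prime = nonTrivial⇒n>1 r {{prime⇒nonTrivial r-prime}}

pow-∣ : ∀ r {i e} → i ≤ e → r ^ i ∣ r ^ e
pow-∣ r {e = e} z≤n = 1∣ (r ^ e)
pow-∣ r (s≤s i≤e) = *-monoʳ-∣ r (pow-∣ r i≤e)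

geomSum-≥ : ∀ r e → r ^ e ≤ geomSum r e
geomSum-≥ r zero = ≤-refl
geomSum-≥ r (suc e) = ≤-trans (*-monoʳ-≤ r (geomSum-≥ r e)) (m≤n+m (r * geomSum r e) 1)

geomSum-closed : ∀ t e → t * geomSum (suc t) e + 1 ≡ suc t ^ suc e
geomSum-closed t zero = base t
  where
  base : ∀ t → t * 1 + 1 ≡ suc t * 1
  base = solve-∀
geomSum-closed t (suc e) = begin
  t * (1 + suc t * geomSum (suc t) e) + 1  ≡⟨ factor t (geomSum (suc t) e) ⟩
  suc t * (t * geomSum (suc t) e + 1)      ≡⟨ cong (suc t *_) (geomSum-closed t e) ⟩
  suc t * suc t ^ suc e                    ∎
  where
  open ≡-Reasoning
  factor : ∀ t g → t * (1 + suc t * g) + 1 ≡ suc t * (t * g + 1)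
  factor = solve-∀

even-or-odd : ∀ n → 2 ∣ n ⊎ 2 ∣ suc n
even-or-odd zero = inj₁ (divides 0 refl)
even-or-odd (suc n) with even-or-odd n
... | inj₁ 2∣n = inj₂ (∣m∣n⇒∣m+n {2} {2} {n} ∣-refl 2∣n)
... | inj₂ 2∣1+n = inj₁ 2∣1+n

oddHalf : ∀ {r} → ¬ 2 ∣ r → 1 < r → ∃ λ h → geomSum r 1 ≡ 2 * h × h < r × r < 2 * h
oddHalf {r} r-odd 1<r with even-or-odd r
... | inj₁ 2∣r = contradiction 2∣r r-odd
... | inj₂ (divides h 1+r≡h*2) = h , σr≡2h , h<r , r<2h
  where
  σr≡2h : geomSum r 1 ≡ 2 * h
  σr≡2h = trans (cong suc (*-identityʳ r)) (trans 1+r≡h*2 (*-comm h 2))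
  r<2h : r < 2 * h
  r<2h = subst (r <_) (trans 1+r≡h*2 (*-comm h 2)) ≤-refl
  h<r : h < r
  h<r = *-cancelˡ-< 2 h r (begin-strict
    2 * h  ≡⟨ trans (*-comm 2 h) (sym 1+r≡h*2) ⟩
    1 + r  <⟨ +-monoˡ-< r 1<r ⟩
    r + r  ≡⟨ cong (r +_) (sym (+-identityʳ r)) ⟩
    2 * r  ∎)
    where open ≤-Reasoning

half≢0 : ∀ {r h} → r < 2 * h → NonZero h
half≢0 {h = zero} ()
half≢0 {h = suc h} _ = _

-- An odd number dividing s + 1 for an odd s cannot be s + 1 itself (which is even), so it is at most s.
odd∣suc⇒≤ : ∀ {d s} → ¬ 2 ∣ d → ¬ 2 ∣ s → d ∣ suc s → d ≤ s
odd∣suc⇒≤ {d} {s} d-odd s-odd d∣1+s = ≤-pred (≤∧≢⇒< (∣⇒≤ d∣1+s) d≢1+s)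
  where
  d≢1+s : d ≢ suc s
  d≢1+s refl with even-or-odd s
  ... | inj₁ 2∣s = s-odd 2∣s
  ... | inj₂ 2∣1+s = d-odd 2∣1+s

-- If X · (Y · S) = 2N with N odd, then X and Y are not both even (else 4 ∣ 2N).
notBothEven : ∀ {X Y S N} → Odd N → X * (Y * S) ≡ 2 * N → 2 ∣ X → 2 ∣ Y → ⊥
notBothEven {S = S} N-odd XYS≡2N 2∣X 2∣Y =
  N-odd (*-cancelˡ-∣ 2 (subst (2 * 2 ∣_) XYS≡2N (*-pres-∣ 2∣X (∣m⇒∣m*n S 2∣Y))))

halfBound : ∀ {A c h N} → 0 < A → c < 2 * h → A * h ≤ N → (A * c) * (A * c) < 6 * (N * N)
halfBound {A} {c} {h} {N} A>0 c<2h Ah≤N = begin-strict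
  (A * c) * (A * c)              ≡⟨ regroup A c ⟩
  (A * A) * (c * c)              <⟨ *-monoʳ-< (A * A) {{>-nonZero (*-mono-< A>0 A>0)}} (*-mono-< c<2h c<2h) ⟩
  (A * A) * ((2 * h) * (2 * h))  ≡⟨ pull-4 A h ⟩
  4 * ((A * h) * (A * h))        ≤⟨ *-mono-≤ {4} {6} (s≤s (s≤s (s≤s (s≤s z≤n)))) (*-mono-≤ Ah≤N Ah≤N) ⟩
  6 * (N * N)                    ∎
  where
  open ≤-Reasoning
  regroup : ∀ A c → (A * c) * (A * c) ≡ (A * A) * (c * c)
  regroup = solve-∀
  pull-4 : ∀ A h → (A * A) * ((2 * h) * (2 * h)) ≡ 4 * ((A * h) * (A * h))
  pull-4 = solve-∀

viaSquare : ∀ p q N X → (p * q) ^ 4 ≡ X * X → X * X < 6 * (N * N) → (p * q) ^ 4 < 6 * N ^ 2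
viaSquare p q N X pq⁴≡X² X²<6N² =
  subst₂ _<_ (sym pq⁴≡X²) (cong (λ n → 6 * (N * n)) (sym (*-identityʳ N))) X²<6N²

boundViaQ : ∀ {p q h N} → 0 < p → 0 < q → q < 2 * h → p * p * q * h ≤ N → (p * q) ^ 4 < 6 * N ^ 2
boundViaQ {p} {q} {N = N} p>0 q>0 q<2h p²qh≤N =
  viaSquare p q N (p * p * q * q) (regroup p q) (halfBound (*-mono-< (*-mono-< p>0 p>0) q>0) q<2h p²qh≤N)
  where
  regroup : ∀ p q → (p * q) * ((p * q) * ((p * q) * ((p * q) * 1))) ≡ (p * p * q * q) * (p * p * q * q)
  regroup = solve-∀

boundViaP : ∀ {p q h N} → 0 < p → 0 < q → p < 2 * h → p * q * q * h ≤ N → (p * q) ^ 4 < 6 * N ^ 2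
boundViaP {p} {q} {N = N} p>0 q>0 p<2h pq²h≤N =
  viaSquare p q N (p * q * q * p) (regroup p q) (halfBound (*-mono-< (*-mono-< p>0 q>0) q>0) p<2h pq²h≤N)
  where
  regroup : ∀ p q → (p * q) * ((p * q) * ((p * q) * ((p * q) * 1))) ≡ (p * q * q * p) * (p * q * q * p)
  regroup = solve-∀

suc-square≤ : ∀ {t} → 1 ≤ t → suc t * suc t ≤ 6 * (t * t)
suc-square≤ {t} 1≤t = begin
  suc t * suc t            ≤⟨ *-mono-≤ 1+t≤2t 1+t≤2t ⟩
  (t + t) * (t + t)        ≡⟨ four-t² t ⟩
  4 * (t * t)              ≤⟨ *-monoˡ-≤ (t * t) {4} {6} (s≤s (s≤s (s≤s (s≤s z≤n)))) ⟩
  6 * (t * t)              ∎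
  where
  open ≤-Reasoning
  1+t≤2t : suc t ≤ t + t
  1+t≤2t = +-monoˡ-≤ t 1≤t
  four-t² : ∀ t → (t + t) * (t + t) ≡ 4 * (t * t)
  four-t² = solve-∀

-- Write p = 1 + t with t ≥ 1; the geometric
-- identity t·(q·s) + 1 = p·P (P = p^a) together with p ≤ s and p ≤ M gives
--   p²·(pq)⁴ = p²·p²·p²·q⁴ ≤ 6t²·s²M²·q⁴ = 6·(t·q·s)²·(qM)² < 6·(p·P)²·(qM)² = p²·6·(P·qM)²,
-- and p² cancels.
geometricBound : ∀ {p q s M} a → 1 < p → p ≤ s → p ≤ M → 0 < q →
                 geomSum p a ≡ s * q → (p * q) ^ 4 < 6 * (p ^ a * (q * M)) ^ 2
geometricBound {suc t} {q} {s} {M} a (s≤s 1≤t) p≤s p≤M q>0 σpᵃ≡sq = *-cancelˡ-< (p * p) _ _ (begin-strict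
  p * p * (p * q) ^ 4                                ≡⟨ expand p q ⟩
  (p * p) * ((p * p) * (p * p)) * ((q * q) * (q * q))  ≤⟨ *-monoˡ-≤ ((q * q) * (q * q))
                                                           (*-mono-≤ (suc-square≤ 1≤t) (*-mono-≤ (square-≤ p≤s) (square-≤ p≤M))) ⟩
  6 * (t * t) * ((s * s) * (M * M)) * ((q * q) * (q * q))  ≡⟨ regroup t s M q ⟩
  6 * (X * X) * K                                    <⟨ *-monoˡ-< K {{K≢0}} (*-monoʳ-< 6 (*-mono-< X<pP X<pP)) ⟩
  6 * ((p * P) * (p * P)) * K                        ≡⟨ collect p P q M ⟩
  p * p * (6 * (P * (q * M)) ^ 2)                    ∎)
  where
  open ≤-Reasoning
  p P X K : ℕ
  p = suc t
  P = p ^ a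
  X = t * (q * s)
  K = (q * M) * (q * M)
  closed : X + 1 ≡ p * P
  closed = trans (cong (λ g → t * g + 1) (trans (*-comm q s) (sym σpᵃ≡sq))) (geomSum-closed t a)
  X<pP : X < p * P
  X<pP = subst (X <_) closed (subst (_≤ X + 1) (+-comm X 1) ≤-refl)
  qM>0 : 0 < q * M
  qM>0 = *-mono-< q>0 (≤-trans (s≤s z≤n) p≤M)
  K≢0 : NonZero K
  K≢0 = >-nonZero (*-mono-< qM>0 qM>0)
  square-≤ : ∀ {a b} → a ≤ b → a * a ≤ b * b
  square-≤ a≤b = *-mono-≤ a≤b a≤b
  expand : ∀ p q → p * p * ((p * q) * ((p * q) * ((p * q) * ((p * q) * 1))))
                   ≡ (p * p) * ((p * p) * (p * p)) * ((q * q) * (q * q))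
  expand = solve-∀
  regroup : ∀ t s M q → 6 * (t * t) * ((s * s) * (M * M)) * ((q * q) * (q * q))
                        ≡ 6 * ((t * (q * s)) * (t * (q * s))) * ((q * M) * (q * M))
  regroup = solve-∀
  collect : ∀ p P q M → 6 * ((p * P) * (p * P)) * ((q * M) * (q * M))
                        ≡ p * p * (6 * ((P * (q * M)) * ((P * (q * M)) * 1)))
  collect = solve-∀

module ExponentCases {N p q M : ℕ} (N-odd : Odd N) (p-prime : Prime p) (q-prime : Prime q)
                     (p-odd : ¬ 2 ∣ p) (q-odd : ¬ 2 ∣ q) (p<q : p < q) (q∤M : ¬ q ∣ M)
                     .{{_ : NonZero M}} where

  instance
    N≢0 : NonZero N
    N≢0 = ≢-nonZero λ { refl → N-odd (divides 0 refl) }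

  p>0 : 0 < p
  p>0 = <-trans z<s (prime>1 p-prime)

  q>0 : 0 < q
  q>0 = <-trans p>0 p<q

  cofactor-divisor : ∀ a b {d} → N ≡ p ^ a * (q ^ b * M) → Coprime d p → Coprime d q → d ∣ N → d ∣ M
  cofactor-divisor a b {d} N≡ d⊥p d⊥q d∣N =
    coprime-pow-divisor d⊥q b (coprime-pow-divisor d⊥p a (subst (d ∣_) N≡ d∣N))

  part-≤ : ∀ a b {i j d} → N ≡ p ^ a * (q ^ b * M) → i ≤ a → j ≤ b → d ∣ M → p ^ i * (q ^ j * d) ≤ N
  part-≤ a b {i} {j} {d} N≡ i≤a j≤b d∣M =
    ∣⇒≤ (subst (p ^ i * (q ^ j * d) ∣_) (sym N≡) (*-pres-∣ (pow-∣ p {i} {a} i≤a) (*-pres-∣ (pow-∣ q {j} {b} j≤b) d∣M)))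

  -- a, b ≥ 2: p²q² ≤ N, which is the bound with h = q.
  bothSquared : ∀ a b → N ≡ p ^ (2 + a) * (q ^ (2 + b) * M) → (p * q) ^ 4 < 6 * N ^ 2
  bothSquared a b N≡ = boundViaQ p>0 q>0 q<2q (subst (_≤ N) (regroup p q) p²q²≤N)
    where
    q<2q : q < 2 * q
    q<2q = subst (q <_) (cong (q +_) (sym (+-identityʳ q))) (m<m+n q q>0)
    p²q²≤N : p ^ 2 * (q ^ 2 * 1) ≤ N
    p²q²≤N = part-≤ (2 + a) (2 + b) N≡ (s≤s (s≤s z≤n)) (s≤s (s≤s z≤n)) (1∣ M)
    regroup : ∀ p q → p * (p * 1) * (q * (q * 1) * 1) ≡ p * p * q * q
    regroup = solve-∀

  -- a = 1, b ≥ 2: σ(p) = p + 1 = 2h divides 2N, so h ∣ N; as h < p < q it is prime to p and q,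
  -- hence h ∣ M and pq²·h ≤ N, while p < 2h.
  exponentOneAtP : ∀ b → N ≡ p ^ 1 * (q ^ (2 + b) * M) →
                   geomSum p 1 * (geomSum q (2 + b) * σ M) ≡ 2 * N → (p * q) ^ 4 < 6 * N ^ 2
  exponentOneAtP b N≡ σN≡2N with oddHalf p-odd (prime>1 p-prime)
  ... | h , σp≡2h , h<p , p<2h = boundViaP p>0 q>0 p<2h (subst (_≤ N) (regroup p q h) pq²h≤N)
    where
    instance
      h≢0 : NonZero h
      h≢0 = half≢0 p<2h
    h∣N : h ∣ N
    h∣N = *-cancelˡ-∣ 2 (subst (2 * h ∣_) σN≡2N
            (subst (_∣ geomSum p 1 * (geomSum q (2 + b) * σ M)) σp≡2h (m∣m*n _)))
    h∣M : h ∣ M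
    h∣M = cofactor-divisor 1 (2 + b) N≡ (coprime-sym (prime⇒coprime p-prime h<p)) (coprime-sym (prime⇒coprime q-prime (<-trans h<p p<q))) h∣N
    pq²h≤N : p ^ 1 * (q ^ 2 * h) ≤ N
    pq²h≤N = part-≤ 1 (2 + b) N≡ ≤-refl (s≤s (s≤s z≤n)) h∣M
    regroup : ∀ p q h → p * 1 * (q * (q * 1) * h) ≡ p * q * q * h
    regroup = solve-∀

  module ExponentOneAtQ (a : ℕ) (N≡ : N ≡ p ^ (2 + a) * (q ^ 1 * M))
                        (σN≡2N : geomSum p (2 + a) * (geomSum q 1 * σ M) ≡ 2 * N)
                        {h : ℕ} (σq≡2h : geomSum q 1 ≡ 2 * h) (h<q : h < q) (q<2h : q < 2 * h) where

    P G S : ℕ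
    P = p ^ (2 + a)
    G = geomSum p (2 + a)
    S = σ M

    σN≡2N′ : G * (2 * h * S) ≡ 2 * N
    σN≡2N′ = subst (λ g → G * (g * S) ≡ 2 * N) σq≡2h σN≡2N

    N≡′ : N ≡ P * (q * M)
    N≡′ = trans N≡ (cong (λ x → P * (x * M)) (*-identityʳ q))

    instance
      h≢0 : NonZero h
      h≢0 = half≢0 q<2h

    -- p ∤ h: as in exponentOneAtP, h ∣ N and h is prime to p and q, so h ∣ M and p²q·h ≤ N.
    viaHalf : ¬ p ∣ h → (p * q) ^ 4 < 6 * N ^ 2
    viaHalf p∤h = boundViaQ p>0 q>0 q<2h (subst (_≤ N) (regroup p q h) p²qh≤N)
      where
      h∣N : h ∣ N
      h∣N = *-cancelˡ-∣ 2 (subst (2 * h ∣_) σN≡2N′ (∣n⇒∣m*n G (m∣m*n S)))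
      h∣M : h ∣ M
      h∣M = cofactor-divisor (2 + a) 1 N≡ (prime∤⇒coprime p-prime p∤h) (coprime-sym (prime⇒coprime q-prime h<q)) h∣N
      p²qh≤N : p ^ 2 * (q ^ 1 * h) ≤ N
      p²qh≤N = part-≤ (2 + a) 1 N≡ (s≤s (s≤s z≤n)) ≤-refl h∣M
      regroup : ∀ p q h → p * (p * 1) * (q * 1 * h) ≡ p * p * q * h
      regroup = solve-∀

    -- q ∣ σ(M): then P·q·2h ≤ σ(p^a)·2h·σ(M) = 2N = P·q·2M, so q < 2h ≤ 2M and h = M works.
    viaσM : q ∣ S → (p * q) ^ 4 < 6 * N ^ 2
    viaσM q∣S = boundViaQ p>0 q>0 (<-≤-trans q<2h 2h≤2M) (subst (_≤ N) (regroup p q M) p²qM≤N)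
      where
      instance
        S≢0 : NonZero S
        S≢0 = m*n≢0⇒n≢0 (2 * h) {{m*n≢0⇒n≢0 G {{subst NonZero (sym σN≡2N′) (m*n≢0 2 N)}}}}
        Pq≢0 : NonZero (P * q)
        Pq≢0 = m*n≢0 P q {{m^n≢0 p (2 + a) {{>-nonZero p>0}}}} {{>-nonZero q>0}}
      2h≤2M : 2 * h ≤ 2 * M
      2h≤2M = *-cancelˡ-≤ (P * q) (begin
        P * q * (2 * h)    ≡⟨ swap P q (2 * h) ⟩
        P * (2 * h * q)    ≤⟨ *-mono-≤ (geomSum-≥ p (2 + a)) (*-monoʳ-≤ (2 * h) (∣⇒≤ q∣S)) ⟩
        G * (2 * h * S)    ≡⟨ σN≡2N′ ⟩
        2 * N              ≡⟨ cong (2 *_) N≡′ ⟩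
        2 * (P * (q * M))  ≡⟨ gather P q M ⟩
        P * q * (2 * M)    ∎)
        where
        open ≤-Reasoning
        swap : ∀ P q x → P * q * x ≡ P * (x * q)
        swap = solve-∀
        gather : ∀ P q M → 2 * (P * (q * M)) ≡ P * q * (2 * M)
        gather = solve-∀
      p²qM≤N : p ^ 2 * (q ^ 1 * M) ≤ N
      p²qM≤N = part-≤ (2 + a) 1 N≡ (s≤s (s≤s z≤n)) ≤-refl ∣-refl
      regroup : ∀ p q M → p * (p * 1) * (q * 1 * M) ≡ p * p * q * M
      regroup = solve-∀

    -- p ∣ h and σ(p^a) = s·q. Then p ≤ s and s ∣ M, and geometricBound applies.
    module σPowerDivisible {s : ℕ} (G≡sq : G ≡ s * q) (p∣h : p ∣ h) where

      -- σ(q) = 2h is even, so σ(p^a) and hence s are odd.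
      s-odd : ¬ 2 ∣ s
      s-odd 2∣s = notBothEven N-odd σN≡2N′ (subst (2 ∣_) (sym G≡sq) (∣m⇒∣m*n q 2∣s)) (m∣m*n h)

      -- Modulo p: s·q = σ(p^a) ≡ 1 and q ≡ -1 (p ∣ h ∣ q + 1), so p ∣ s + 1.
      p∣1+s : p ∣ suc s
      p∣1+s = ∣m+n∣m⇒∣n (subst (p ∣_) s·2h≡ (∣n⇒∣m*n s (∣-trans p∣h (n∣m*n 2)))) (m∣m*n H)
        where
        H : ℕ
        H = geomSum p (1 + a)
        open ≡-Reasoning
        s·2h≡ : s * (2 * h) ≡ p * H + suc s
        s·2h≡ = begin
          s * (2 * h)        ≡⟨ cong (s *_) σq≡2h ⟨
          s * (1 + q * 1)    ≡⟨ expand s q ⟩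
          s + s * q          ≡⟨ cong (s +_) G≡sq ⟨
          s + (1 + p * H)    ≡⟨ +-comm s (1 + p * H) ⟩
          1 + p * H + s      ≡⟨ +-suc (p * H) s ⟨
          p * H + suc s      ∎
          where
          expand : ∀ s q → s * (1 + q * 1) ≡ s + s * q
          expand = solve-∀

      p≤s : p ≤ s
      p≤s = odd∣suc⇒≤ p-odd s-odd p∣1+s

      p∤s : ¬ p ∣ s
      p∤s p∣s = contradiction (∣1⇒≡1 (∣m+n∣m⇒∣n (subst (p ∣_) (+-comm 1 s) p∣1+s) p∣s)) (>⇒≢ (prime>1 p-prime))

      -- q ∤ s: otherwise q² ∣ σ(p^a) ∣ 2N = 2·P·q·M, so q ∣ 2·P·M, forcing q ∣ M.
      q∤s : ¬ q ∣ s
      q∤s (divides t refl) with euclidsLemma 2 (P * M) q-prime q∣2PM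
        where
        instance _ = >-nonZero q>0
        q∣2PM : q ∣ 2 * (P * M)
        q∣2PM = divides (t * (2 * h * S)) (*-cancelˡ-≡ _ _ q (begin
          q * (2 * (P * M))        ≡⟨ pull-q q P M ⟩
          2 * (P * (q * M))        ≡⟨ cong (2 *_) N≡′ ⟨
          2 * N                    ≡⟨ σN≡2N′ ⟨
          G * (2 * h * S)          ≡⟨ cong (_* (2 * h * S)) G≡sq ⟩
          t * q * q * (2 * h * S)  ≡⟨ push-q t q (2 * h * S) ⟩
          q * (t * (2 * h * S) * q)  ∎))
          where
          open ≡-Reasoning
          pull-q : ∀ q P M → q * (2 * (P * M)) ≡ 2 * (P * (q * M))
          pull-q = solve-∀
          push-q : ∀ t q x → t * q * q * x ≡ q * (t * x * q)
          push-q = solve-∀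
      ... | inj₁ q∣2 = <⇒≱ (≤-<-trans (prime>1 p-prime) p<q) (∣⇒≤ q∣2)
      ... | inj₂ q∣PM = q∤M (coprime-pow-divisor (prime⇒coprime q-prime p<q) (2 + a) q∣PM)
        where instance _ = >-nonZero p>0

      -- s ∣ σ(p^a) ∣ 2N with s odd, and s is prime to p and q, so s ∣ M; in particular p ≤ M.
      s∣M : s ∣ M
      s∣M = cofactor-divisor (2 + a) 1 N≡ (prime∤⇒coprime p-prime p∤s) (prime∤⇒coprime q-prime q∤s)
              (coprime-divisor (prime∤⇒coprime prime[2] s-odd) s∣2N)
        where
        s∣2N : s ∣ 2 * N
        s∣2N = subst (s ∣_) σN≡2N′ (∣m⇒∣m*n (2 * h * S) (subst (s ∣_) (sym G≡sq) (m∣m*n q)))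

      bound : (p * q) ^ 4 < 6 * N ^ 2
      bound = subst (λ n → (p * q) ^ 4 < 6 * n ^ 2) (sym N≡′)
        (geometricBound (2 + a) (prime>1 p-prime) p≤s (≤-trans p≤s (∣⇒≤ s∣M)) q>0 G≡sq)

    -- Either p ∤ h, or q divides one of the factors σ(p^a), σ(M) of 2N (it cannot divide 2h = q + 1).
    bound : (p * q) ^ 4 < 6 * N ^ 2
    bound with p ∣? h
    ... | no p∤h = viaHalf p∤h
    ... | yes p∣h with euclidsLemma G (2 * h * S) q-prime q∣2N
      where
      q∣2N : q ∣ G * (2 * h * S)
      q∣2N = subst (q ∣_) (sym σN≡2N′) (∣n⇒∣m*n 2 (subst (q ∣_) (sym N≡′) (∣n⇒∣m*n P (m∣m*n M))))
    ...   | inj₁ (divides s G≡sq) = σPowerDivisible.bound {s} G≡sq p∣h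
    ...   | inj₂ q∣2hS with euclidsLemma (2 * h) S q-prime q∣2hS
    ...     | inj₂ q∣S = viaσM q∣S
    ...     | inj₁ q∣2h = contradiction (∣1⇒≡1 (∣m+n∣m⇒∣n q∣q+1 (m∣m*n 1))) (>⇒≢ (prime>1 q-prime))
      where
      q∣q+1 : q ∣ q * 1 + 1
      q∣q+1 = subst (q ∣_) (trans (sym σq≡2h) (+-comm 1 (q * 1))) q∣2h

  σ-odd-prime-even : ∀ {r} → Prime r → ¬ 2 ∣ r → 2 ∣ geomSum r 1
  σ-odd-prime-even r-prime r-odd with oddHalf r-odd (prime>1 r-prime)
  ... | h , σr≡2h , _ = subst (2 ∣_) (sym σr≡2h) (m∣m*n h)

  -- Dispatch on the exponents 1 + a and 1 + b. When both are 1, σ(p) and σ(q) are both even, so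
  -- 4 ∣ 2N, contradicting N odd; the other three shapes are handled above.
  bound : ∀ a b → N ≡ p ^ suc a * (q ^ suc b * M) →
          geomSum p (suc a) * (geomSum q (suc b) * σ M) ≡ 2 * N → (p * q) ^ 4 < 6 * N ^ 2
  bound zero zero _ σN≡2N =
    ⊥-elim (notBothEven N-odd σN≡2N (σ-odd-prime-even p-prime p-odd) (σ-odd-prime-even q-prime q-odd))
  bound zero (suc b) = exponentOneAtP b
  bound (suc a) zero N≡ σN≡2N with oddHalf q-odd (prime>1 q-prime)
  ... | h , σq≡2h , h<q , q<2h = ExponentOneAtQ.bound a N≡ σN≡2N σq≡2h h<q q<2h
  bound (suc a) (suc b) N≡ _ = bothSquared a b N≡

record PrimePairSplit (N p q : ℕ) : Set where
  field
    a b M : ℕ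
    M≢0 : NonZero M
    q∤M : ¬ q ∣ M
    N≡ : N ≡ p ^ suc a * (q ^ suc b * M)
    σN≡ : σ N ≡ geomSum p (suc a) * (geomSum q (suc b) * σ M)

-- Split off the p-part and then the q-part of N; both exponents are positive because p, q ∣ N
-- (for q via coprimality with p).
splitPrimePair : ∀ {N p q} → Prime p → Prime q → p < q → p ∣ N → q ∣ N → N ≢ 0 → PrimePairSplit N p q
splitPrimePair {N} {p} {q} p-prime q-prime p<q p∣N q∣N N≢0 with splitPower (prime>1 p-prime) N N≢0
... | zero , X , N≡X , p∤X = contradiction (subst (p ∣_) (trans N≡X (*-identityˡ X)) p∣N) p∤X
... | suc a , X , N≡pᵃX , p∤X with splitPower (prime>1 q-prime) X (λ { refl → N≢0 (trans N≡pᵃX (*-zeroʳ (p ^ suc a))) })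
...   | zero , M , X≡M , q∤M = contradiction (subst (q ∣_) (trans X≡M (*-identityˡ M)) q∣X) q∤M
  where
  q∣X : q ∣ X
  q∣X = coprime-pow-divisor (prime⇒coprime q-prime {{prime⇒nonZero p-prime}} p<q) (suc a) (subst (q ∣_) N≡pᵃX q∣N)
...   | suc b , M , X≡qᵇM , q∤M = record
  { a = a ; b = b ; M = M ; M≢0 = M≢0 ; q∤M = q∤M
  ; N≡ = trans N≡pᵃX (cong (p ^ suc a *_) X≡qᵇM)
  ; σN≡ = begin
      σ N                                            ≡⟨ cong σ N≡pᵃX ⟩
      σ (p ^ suc a * X)                              ≡⟨ PrimePowerPart.σ-prime-power p-prime p∤X (suc a) ⟩
      geomSum p (suc a) * σ X                        ≡⟨ cong (λ x → geomSum p (suc a) * σ x) X≡qᵇM ⟩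
      geomSum p (suc a) * σ (q ^ suc b * M)          ≡⟨ cong (geomSum p (suc a) *_) (PrimePowerPart.σ-prime-power q-prime q∤M (suc b)) ⟩
      geomSum p (suc a) * (geomSum q (suc b) * σ M)  ∎
  }
  where
  open ≡-Reasoning
  instance
    X≢0 : NonZero X
    X≢0 = ≢-nonZero λ { refl → N≢0 (trans N≡pᵃX (*-zeroʳ (p ^ suc a))) }
    M≢0 : NonZero M
    M≢0 = ≢-nonZero λ { refl → ≢-nonZero⁻¹ X (trans X≡qᵇM (*-zeroʳ (q ^ suc b))) }

-- The theorem.
mainTheorem2 : (N p q : ℕ) → Odd N → Perfect N →
    Prime p → p ∣ N → Prime q → q ∣ N → p < q →
    ((r : ℕ) → Prime r → r ∣ N → r ≤ p ⊎ r ≡ q) →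
    (p * q) ^ 4 < 6 * N ^ 2
mainTheorem2 N p q N-odd N-perfect p-prime p∣N q-prime q∣N p<q _ =
  ExponentCases.bound N-odd p-prime q-prime (odd-divisor p∣N) (odd-divisor q∣N) p<q q∤M {{M≢0}}
    a b N≡ (trans (sym σN≡) N-perfect)
  where
  N≢0 : N ≢ 0
  N≢0 refl = N-odd (divides 0 refl)
  open PrimePairSplit (splitPrimePair p-prime q-prime p<q p∣N q∣N N≢0)
  odd-divisor : ∀ {d} → d ∣ N → ¬ 2 ∣ d
  odd-divisor d∣N 2∣d = N-odd (∣-trans 2∣d d∣N)
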